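{- Let $Q=(U,\Omega,r)$ be a connected tight multimatroid containing an element $e$ such that $Q|\{e\}$ is disconnected. If $X$ is a proper separator of $Q|\{e\}$, then $Q$ has a circuit $C$ such that $e\in C\subseteq X\cup\{e\}$.
   Context: A multimatroid $Q=(U,\Omega,r)$ consists of a finite set $U$, a partition $\Omega$ of $U$ into skew classes (two distinct elements of the same skew class form a skew pair), and a function $r$ from the set of subtransversals (sets meeting each skew class in at most one element) to the non-negative integers satisfying: (1) $r(\emptyset)=0$; (2) $r(A)\le r(A\cup x)\le r(A)+1$ whenever $x$ lies in a skew class avoiding the subtransversal $A$; (3) $r(A)+r(B)\ge r(A\cup B)+r(A\cap B)$ whenever $A\cup B$ is a subtransversal; (4) $r(A\cup x)-r(A)+r(A\cup y)-r(A)\ge 1$ whenever $\{x,y\}$ is a skew pair in a skew class avoiding the subtransversal $A$. A subtransversal $S$ is independent if $r(S)=|S|$, otherwise dependent; a circuit is a dependent subtransversal all of whose proper subsets are independent. For a subtransversal $A$, $Q|A$ is the multimatroid whose skew classes are those of $Q$ disjoint from $A$, with ground set their union and rank function $X\mapsto r(X\cup A)-r(A)$. A separator of a multimatroid is a union $X$ of skew classes with $r(S)=r(S\cap X)+r(S-X)$ for every subtransversal $S$; it is proper if it is neither empty nor the whole ground set; the multimatroid is connected if it has no proper separator. $Q$ is tight if no skew class has size 1 and for every skew class $\omega$ and every subtransversal $A$ meeting all skew classes except $\omega$, $\sum_{x\in\omega}(r(A\cup x)-r(A))=|\omega|-1$. -}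

module Defs where

open import Data.Nat using (ℕ; zero; suc; _+_; _∸_; _≤_)
open import Data.Bool using (if_then_else_)
open import Data.Fin using (Fin; _≟_)
open import Data.Fin.Subset using (Subset; _∈_; _∉_; _⊆_; _∩_; _∪_; _─_; ⁅_⁆; ⊤; ⊥; ∣_∣; Nonempty)
open import Data.Unit using () renaming (⊤ to Unit)
open import Data.Product using (Σ; ∃; _×_; ∃-syntax)
open import Relation.Binary.PropositionalEquality using (_≡_; _≢_)
open import Relation.Nullary using (¬_; does)

sumFin : ∀ {n} → (Fin n → ℕ) → ℕ
sumFin {zero} f = 0
sumFin {suc n} f = f Fin.zero + sumFin (λ i → f (Fin.suc i))

module _ {n k : ℕ} (cls : Fin n → Fin k) where

  IsSubtransversal : Subset n → Set
  IsSubtransversal S = ∀ x y → x ∈ S → y ∈ S → cls x ≡ cls y → x ≡ y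

  ClassAvoids : Fin k → Subset n → Set
  ClassAvoids c A = ∀ y → y ∈ A → cls y ≢ c

  classSize : Fin k → ℕ
  classSize c = sumFin (λ x → if does (cls x ≟ c) then 1 else 0)

  -- Notions for a "multimatroid-like" structure with ground set G ⊆ Fin n,
  -- skew classes given by cls (restricted to G), and rank function ρ.
  module OnGround (G : Fin n → Set) (ρ : Subset n → ℕ) where

    IsSubtransversalIn : Subset n → Set
    IsSubtransversalIn S = (∀ x → x ∈ S → G x) × IsSubtransversal S

    IsUnionOfClasses : Subset n → Set
    IsUnionOfClasses X = (∀ x → x ∈ X → G x) ×
      (∀ x y → x ∈ X → G y → cls x ≡ cls y → y ∈ X)

    IsSeparator : Subset n → Set
    IsSeparator X = IsUnionOfClasses X ×
      (∀ S → IsSubtransversalIn S → ρ S ≡ ρ (S ∩ X) + ρ (S ─ X))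

    IsProper : Subset n → Set
    IsProper X = Nonempty X × ∃[ y ] (G y × y ∉ X)

    IsConnected : Set
    IsConnected = ∀ X → IsSeparator X → ¬ IsProper X

    IsDisconnected : Set
    IsDisconnected = ∃[ X ] (IsSeparator X × IsProper X)

-- The rank function is given on all subsets but axioms only concern
-- subtransversals (and only its values on subtransversals are ever used).
record Multimatroid (n : ℕ) : Set where
  field
    k     : ℕ
    cls   : Fin n → Fin k
    -- skew classes are the (nonempty) blocks of a partition
    cls-surj : ∀ c → ∃[ x ] (cls x ≡ c)
    r     : Subset n → ℕ
    r-empty : r ⊥ ≡ 0
    r-unit  : ∀ A x → IsSubtransversal cls A → ClassAvoids cls (cls x) A →
              r A ≤ r (A ∪ ⁅ x ⁆) × r (A ∪ ⁅ x ⁆) ≤ suc (r A)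
    r-submod : ∀ A B → IsSubtransversal cls (A ∪ B) →
               r (A ∪ B) + r (A ∩ B) ≤ r A + r B
    r-skew : ∀ A x y → IsSubtransversal cls A → ClassAvoids cls (cls x) A →
             x ≢ y → cls x ≡ cls y →
             1 ≤ (r (A ∪ ⁅ x ⁆) ∸ r A) + (r (A ∪ ⁅ y ⁆) ∸ r A)

module _ {n : ℕ} (Q : Multimatroid n) where
  open Multimatroid Q

  IsTight : Set
  IsTight =
    (∀ c → 2 ≤ classSize cls c) ×
    (∀ c A → IsSubtransversal cls A → ClassAvoids cls c A →
       (∀ c' → c' ≢ c → ∃[ x ] (x ∈ A × cls x ≡ c')) →
       sumFin (λ x → if does (cls x ≟ c) then r (A ∪ ⁅ x ⁆) ∸ r A else 0)
         ≡ classSize cls c ∸ 1)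

  IsIndependent : Subset n → Set
  IsIndependent S = r S ≡ ∣ S ∣

  IsCircuit : Subset n → Set
  IsCircuit C = IsSubtransversal cls C × ¬ IsIndependent C ×
    (∀ D → D ⊆ C → D ≢ C → IsIndependent D)

  module Whole = OnGround cls (λ _ → Unit) r

  InMinorGround : Subset n → Fin n → Set
  InMinorGround A y = ClassAvoids cls (cls y) A

  module Minor (A : Subset n) = OnGround cls (InMinorGround A) (λ X → r (X ∪ A) ∸ r A)

-- Call e spanned by a subtransversal A when r (A ∪ e) = r A. If some subtransversal A ⊆ X spans
-- e (A = ∅ if e is a loop), removing elements of A while e stays spanned ends in a set D with
-- D ∪ e a circuit. Otherwise e raises the rank of every subtransversal of X by one, and X turns
-- out to be a separator of Q, contradicting connectivity. Together with the separator equation of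
-- Q|e this gives r S = r (S ∩ X) + r (S ─ X) for subtransversals S avoiding the class ω of e.
-- For a transversal S ∪ t with t ∈ ω, tightness enters: a subtransversal spans at most one element
-- of any class it avoids, and exactly one if it meets all other classes. The key point is that
-- B = S ─ X spans an element of ω: by induction on A ⊆ X, downward from the subtransversals meeting
-- every class of X, some element of ω is spanned by B ∪ A. Hence t is spanned by S exactly when it
-- is spanned by B, which is the equation for S ∪ t; subtransversals inherit it by submodularity.

module Submission where

open import Defs
open import Data.Nat using (ℕ; zero; suc; _+_; _∸_; _≤_; _<_; z≤n; s≤s)
open import Data.Nat.Properties renaming (_≟_ to _≟ℕ_)
open import Data.Bool using (if_then_else_)
open import Data.Fin using (Fin; zero; suc; _≟_)
open import Data.Fin.Properties using (any?; all?)
open import Data.Fin.Subset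
open import Data.Fin.Subset.Properties
open import Data.Fin.Subset.Induction using (⊂-wellFounded; ⊃-wellFounded)
open import Induction.WellFounded using (Acc; acc)
open import Data.Vec using (_∷_; here; there)
open import Data.Sum using (_⊎_; inj₁; inj₂; [_,_])
open import Data.Product using (_×_; _,_; proj₁; proj₂; ∃-syntax)
open import Data.Empty using (⊥-elim)
open import Data.Unit using (tt) renaming (⊤ to Unit)
open import Relation.Nullary using (¬_; Dec; yes; no; does)
open import Relation.Nullary.Decidable using (_×-dec_; _→-dec_; ¬?; decidable-stable)
open import Relation.Binary.PropositionalEquality hiding ([_])

private variable
  n : ℕ
  p q s : Subset n
  x y : Fin n
  f g : Fin n → ℕ

x∈p─q⇒x∉q : x ∈ p ─ q → x ∉ q
x∈p─q⇒x∉q {p = inside ∷ p} {q = outside ∷ q} here ()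
x∈p─q⇒x∉q {p = _ ∷ p} {q = _ ∷ q} (there m) (there m′) = x∈p─q⇒x∉q m m′

⊆⇒≡⊎⊂ : p ⊆ q → p ≡ q ⊎ p ⊂ q
⊆⇒≡⊎⊂ {p = p} {q = q} p⊆q with nonempty? (q ─ p)
... | yes (x , x∈q─p) = inj₂ (p⊆q , x , p─q⊆p q p x∈q─p , x∈p─q⇒x∉q x∈q─p)
... | no q─p-empty = inj₁ (⊆-antisym p⊆q q⊆p)
  where
  q⊆p : q ⊆ p
  q⊆p {x} x∈q with x ∈? p
  ... | yes x∈p = x∈p
  ... | no x∉p = ⊥-elim (q─p-empty (x , x∈p∧x∉q⇒x∈p─q x∈q x∉p))

p⊆q⇒p∪q≡q : p ⊆ q → p ∪ q ≡ q
p⊆q⇒p∪q≡q {p = p} {q = q} p⊆q = ⊆-antisym (λ m → [ p⊆q , (λ m′ → m′) ] (x∈p∪q⁻ p q m)) (q⊆p∪q p q)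

p⊆q⇒p∩q≡p : p ⊆ q → p ∩ q ≡ p
p⊆q⇒p∩q≡p {p = p} {q = q} p⊆q = ⊆-antisym (p∩q⊆p p q) (λ m → x∈p∩q⁺ (m , p⊆q m))

p⊆q⇒p∪s⊆q∪s : p ⊆ q → p ∪ s ⊆ q ∪ s
p⊆q⇒p∪s⊆q∪s {p = p} {s = s} p⊆q m =
  x∈p∪q⁺ ([ (λ x∈p → inj₁ (p⊆q x∈p)) , inj₂ ] (x∈p∪q⁻ p s m))

p⊆q⇒p∩s⊆q∩s : p ⊆ q → p ∩ s ⊆ q ∩ s
p⊆q⇒p∩s⊆q∩s {p = p} {s = s} p⊆q m = let x∈p , x∈s = x∈p∩q⁻ p s m in x∈p∩q⁺ (p⊆q x∈p , x∈s)

p⊆q⇒p─s⊆q─s : p ⊆ q → p ─ s ⊆ q ─ s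
p⊆q⇒p─s⊆q─s {p = p} {s = s} p⊆q m = x∈p∧x∉q⇒x∈p─q (p⊆q (p─q⊆p p s m)) (x∈p─q⇒x∉q m)

p⊆q∧q∩s≡⊥⇒p∩s≡⊥ : p ⊆ q → q ∩ s ≡ ⊥ → p ∩ s ≡ ⊥
p⊆q∧q∩s≡⊥⇒p∩s≡⊥ {p = p} {q = q} {s = s} p⊆q q∩s≡⊥ = begin
  p ∩ s        ≡⟨ cong (_∩ s) (sym (p⊆q⇒p∩q≡p p⊆q)) ⟩
  (p ∩ q) ∩ s  ≡⟨ ∩-assoc p q s ⟩
  p ∩ (q ∩ s)  ≡⟨ cong (p ∩_) q∩s≡⊥ ⟩
  p ∩ ⊥        ≡⟨ ∩-zeroʳ p ⟩
  ⊥            ∎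
  where open ≡-Reasoning

[p∩q]∪[p─q]≡p : ∀ (p q : Subset n) → p ∩ q ∪ (p ─ q) ≡ p
[p∩q]∪[p─q]≡p p q = ⊆-antisym
  (λ m → [ p∩q⊆p p q , p─q⊆p p q ] (x∈p∪q⁻ (p ∩ q) (p ─ q) m))
  split
  where
  split : p ⊆ p ∩ q ∪ (p ─ q)
  split {x} x∈p with x ∈? q
  ... | yes x∈q = x∈p∪q⁺ (inj₁ (x∈p∩q⁺ (x∈p , x∈q)))
  ... | no x∉q = x∈p∪q⁺ (inj₂ (x∈p∧x∉q⇒x∈p─q x∈p x∉q))

[p∩q]∩[p─q]≡⊥ : ∀ (p q : Subset n) → (p ∩ q) ∩ (p ─ q) ≡ ⊥
[p∩q]∩[p─q]≡⊥ p q = ⊆-antisym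
  (λ m → let a , b = x∈p∩q⁻ (p ∩ q) (p ─ q) m in ⊥-elim (x∈p─q⇒x∉q b (p∩q⊆q p q a)))
  ⊥⊆

disjoint∧q⊆s⇒[p∪q]∩s≡q : (∀ {x} → x ∈ p → x ∉ s) → q ⊆ s → (p ∪ q) ∩ s ≡ q
disjoint∧q⊆s⇒[p∪q]∩s≡q {p = p} {s = s} {q = q} disjoint q⊆s = ⊆-antisym
  (λ m → let y∈p∪q , y∈s = x∈p∩q⁻ (p ∪ q) s m in
         [ (λ y∈p → ⊥-elim (disjoint y∈p y∈s)) , (λ y∈q → y∈q) ] (x∈p∪q⁻ p q y∈p∪q))
  (λ y∈q → x∈p∩q⁺ (q⊆p∪q p q y∈q , q⊆s y∈q))

disjoint∧q⊆s⇒[p∪q]─s≡p : (∀ {x} → x ∈ p → x ∉ s) → q ⊆ s → (p ∪ q) ─ s ≡ p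
disjoint∧q⊆s⇒[p∪q]─s≡p {p = p} {s = s} {q = q} disjoint q⊆s = ⊆-antisym
  (λ m → [ (λ y∈p → y∈p) , (λ y∈q → ⊥-elim (x∈p─q⇒x∉q m (q⊆s y∈q))) ] (x∈p∪q⁻ p q (p─q⊆p (p ∪ q) s m)))
  (λ y∈p → x∈p∧x∉q⇒x∈p─q (p⊆p∪q q y∈p) (disjoint y∈p))

x∉p-x : x ∉ p - x
x∉p-x {x = x} m = x∈p─q⇒x∉q m (x∈⁅x⁆ x)

p-x⊆p : p - x ⊆ p
p-x⊆p {p = p} {x = x} = p─q⊆p p ⁅ x ⁆

p-x-y⊆p-y : p - x - y ⊆ p - y
p-x-y⊆p-y {p = p} {x = x} {y = y} m rewrite p─x─y≡p─y─x p x y = p-x⊆p m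

p⊆q∧x∉p⇒p⊆q-x : p ⊆ q → x ∉ p → p ⊆ q - x
p⊆q∧x∉p⇒p⊆q-x p⊆q x∉p y∈p = x∈p∧x≢y⇒x∈p-y (p⊆q y∈p) (λ { refl → x∉p y∈p })

infixl 5 _∪⁅_⁆
_∪⁅_⁆ : Subset n → Fin n → Subset n
p ∪⁅ x ⁆ = p ∪ ⁅ x ⁆

x∈p∪⁅x⁆ : x ∈ p ∪⁅ x ⁆
x∈p∪⁅x⁆ {x = x} = x∈p∪q⁺ (inj₂ (x∈⁅x⁆ x))

p⊆p∪⁅x⁆ : p ⊆ p ∪⁅ x ⁆
p⊆p∪⁅x⁆ {x = x} = p⊆p∪q ⁅ x ⁆

y∈p∪⁅x⁆⁻ : y ∈ p ∪⁅ x ⁆ → y ∈ p ⊎ y ≡ x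
y∈p∪⁅x⁆⁻ {p = p} {x = x} m = [ inj₁ , (λ y∈⁅x⁆ → inj₂ (x∈⁅y⁆⇒x≡y x y∈⁅x⁆)) ] (x∈p∪q⁻ p ⁅ x ⁆ m)

p⊆q∧x∈q⇒p∪⁅x⁆⊆q : p ⊆ q → x ∈ q → p ∪⁅ x ⁆ ⊆ q
p⊆q∧x∈q⇒p∪⁅x⁆⊆q p⊆q x∈q m with y∈p∪⁅x⁆⁻ m
... | inj₁ y∈p = p⊆q y∈p
... | inj₂ refl = x∈q

∪⁅⁆-mono : p ⊆ q → p ∪⁅ x ⁆ ⊆ q ∪⁅ x ⁆
∪⁅⁆-mono p⊆q = p⊆q∧x∈q⇒p∪⁅x⁆⊆q (λ m → p⊆p∪⁅x⁆ (p⊆q m)) x∈p∪⁅x⁆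

∪⁅⁆-comm : p ∪⁅ x ⁆ ∪⁅ y ⁆ ≡ p ∪⁅ y ⁆ ∪⁅ x ⁆
∪⁅⁆-comm {p = p} {x = x} {y = y} = begin
  (p ∪ ⁅ x ⁆) ∪ ⁅ y ⁆ ≡⟨ ∪-assoc p _ _ ⟩
  p ∪ (⁅ x ⁆ ∪ ⁅ y ⁆) ≡⟨ cong (p ∪_) (∪-comm ⁅ x ⁆ ⁅ y ⁆) ⟩
  p ∪ (⁅ y ⁆ ∪ ⁅ x ⁆) ≡⟨ sym (∪-assoc p _ _) ⟩
  (p ∪ ⁅ y ⁆) ∪ ⁅ x ⁆ ∎
  where open ≡-Reasoning

x∉p⇒p⊂p∪⁅x⁆ : x ∉ p → p ⊂ p ∪⁅ x ⁆
x∉p⇒p⊂p∪⁅x⁆ x∉p = p⊆p∪⁅x⁆ , _ , x∈p∪⁅x⁆ , x∉p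

∣p∪⁅x⁆∣≡1+∣p∣ : x ∉ p → ∣ p ∪⁅ x ⁆ ∣ ≡ suc ∣ p ∣
∣p∪⁅x⁆∣≡1+∣p∣ {x = zero} {p = outside ∷ p} _ = cong suc (cong ∣_∣ (∪-identityʳ p))
∣p∪⁅x⁆∣≡1+∣p∣ {x = zero} {p = inside ∷ p} x∉p = ⊥-elim (x∉p here)
∣p∪⁅x⁆∣≡1+∣p∣ {x = suc x} {p = outside ∷ p} x∉p = ∣p∪⁅x⁆∣≡1+∣p∣ (λ m → x∉p (there m))
∣p∪⁅x⁆∣≡1+∣p∣ {x = suc x} {p = inside ∷ p} x∉p = cong suc (∣p∪⁅x⁆∣≡1+∣p∣ (λ m → x∉p (there m)))

p-x∪⁅x⁆≡p : x ∈ p → p - x ∪⁅ x ⁆ ≡ p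
p-x∪⁅x⁆≡p {x = x} {p = p} x∈p = ⊆-antisym (p⊆q∧x∈q⇒p∪⁅x⁆⊆q p-x⊆p x∈p) p⊆p-x∪⁅x⁆
  where
  p⊆p-x∪⁅x⁆ : p ⊆ p - x ∪⁅ x ⁆
  p⊆p-x∪⁅x⁆ {y} y∈p with y ≟ x
  ... | yes refl = x∈p∪⁅x⁆
  ... | no y≢x = p⊆p∪⁅x⁆ (x∈p∧x≢y⇒x∈p-y y∈p y≢x)

∣p∣≡1+∣p-x∣ : x ∈ p → ∣ p ∣ ≡ suc ∣ p - x ∣
∣p∣≡1+∣p-x∣ {x = x} {p = p} x∈p = begin
  ∣ p ∣               ≡⟨ cong ∣_∣ (sym (p-x∪⁅x⁆≡p x∈p)) ⟩
  ∣ p - x ∪⁅ x ⁆ ∣    ≡⟨ ∣p∪⁅x⁆∣≡1+∣p∣ (x∉p-x {p = p}) ⟩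
  suc ∣ p - x ∣       ∎
  where open ≡-Reasoning

p⊆q∪⁅x⁆∧x∉p⇒p⊆q : p ⊆ q ∪⁅ x ⁆ → x ∉ p → p ⊆ q
p⊆q∪⁅x⁆∧x∉p⇒p⊆q p⊆ x∉p z∈p with y∈p∪⁅x⁆⁻ (p⊆ z∈p)
... | inj₁ z∈q  = z∈q
... | inj₂ refl = ⊥-elim (x∉p z∈p)

p⊆q∪⁅x⁆∧y∉p⇒p⊆q-y∪⁅x⁆ : p ⊆ q ∪⁅ x ⁆ → y ∉ p → p ⊆ q - y ∪⁅ x ⁆
p⊆q∪⁅x⁆∧y∉p⇒p⊆q-y∪⁅x⁆ p⊆ y∉p z∈p with y∈p∪⁅x⁆⁻ (p⊆ z∈p)
... | inj₁ z∈q  = p⊆p∪⁅x⁆ (x∈p∧x≢y⇒x∈p-y z∈q (λ { refl → y∉p z∈p }))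
... | inj₂ refl = x∈p∪⁅x⁆

p⊆q⇒[p∪⁅x⁆]∪q≡q∪⁅x⁆ : p ⊆ q → (p ∪⁅ x ⁆) ∪ q ≡ q ∪⁅ x ⁆
p⊆q⇒[p∪⁅x⁆]∪q≡q∪⁅x⁆ {p = p} {q = q} {x = x} p⊆q = begin
  (p ∪ ⁅ x ⁆) ∪ q  ≡⟨ ∪-assoc p ⁅ x ⁆ q ⟩
  p ∪ (⁅ x ⁆ ∪ q)  ≡⟨ cong (p ∪_) (∪-comm ⁅ x ⁆ q) ⟩
  p ∪ (q ∪ ⁅ x ⁆)  ≡⟨ p⊆q⇒p∪q≡q (λ m → p⊆p∪⁅x⁆ (p⊆q m)) ⟩
  q ∪ ⁅ x ⁆        ∎
  where open ≡-Reasoning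

x∉q⇒[p∪⁅x⁆]∩q≡p∩q : x ∉ q → (p ∪⁅ x ⁆) ∩ q ≡ p ∩ q
x∉q⇒[p∪⁅x⁆]∩q≡p∩q {x = x} {q = q} {p = p} x∉q = ⊆-antisym
  (λ m → let y∈p∪⁅x⁆ , y∈q = x∈p∩q⁻ (p ∪⁅ x ⁆) q m in
         [ (λ y∈p → x∈p∩q⁺ (y∈p , y∈q)) , (λ { refl → ⊥-elim (x∉q y∈q) }) ] (y∈p∪⁅x⁆⁻ y∈p∪⁅x⁆))
  (p⊆q⇒p∩s⊆q∩s p⊆p∪⁅x⁆)

x∉q⇒[p∪⁅x⁆]─q≡[p─q]∪⁅x⁆ : x ∉ q → (p ∪⁅ x ⁆) ─ q ≡ p ─ q ∪⁅ x ⁆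
x∉q⇒[p∪⁅x⁆]─q≡[p─q]∪⁅x⁆ {x = x} {q = q} {p = p} x∉q = ⊆-antisym
  (λ m → [ (λ y∈p → p⊆p∪⁅x⁆ (x∈p∧x∉q⇒x∈p─q y∈p (x∈p─q⇒x∉q m))) , (λ { refl → x∈p∪⁅x⁆ }) ]
           (y∈p∪⁅x⁆⁻ (p─q⊆p (p ∪⁅ x ⁆) q m)))
  (p⊆q∧x∈q⇒p∪⁅x⁆⊆q (p⊆q⇒p─s⊆q─s p⊆p∪⁅x⁆) (x∈p∧x∉q⇒x∈p─q x∈p∪⁅x⁆ x∉q))

sumFin-mono : (∀ i → f i ≤ g i) → sumFin f ≤ sumFin g
sumFin-mono {zero}  f≤g = z≤n
sumFin-mono {suc n} f≤g = +-mono-≤ (f≤g zero) (sumFin-mono (λ i → f≤g (suc i)))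

sumFin-mono-< : (∀ i → f i ≤ g i) → ∀ i → f i < g i → suc (sumFin f) ≤ sumFin g
sumFin-mono-< {suc n} f≤g zero    fi<gi = +-mono-≤ fi<gi (sumFin-mono (λ i → f≤g (suc i)))
sumFin-mono-< {suc n} {f} {g} f≤g (suc i) fi<gi = subst (_≤ sumFin g) (+-suc (f zero) _)
  (+-mono-≤ (f≤g zero) (sumFin-mono-< (λ j → f≤g (suc j)) i fi<gi))

sumFin-mono-<₂ : (∀ i → f i ≤ g i) → ∀ i j → i ≢ j → f i < g i → f j < g j →
                 2 + sumFin f ≤ sumFin g
sumFin-mono-<₂ {suc n} f≤g zero zero i≢j _ _ = ⊥-elim (i≢j refl)
sumFin-mono-<₂ {suc n} {f} {g} f≤g zero (suc j) _ fi<gi fj<gj = subst (_≤ sumFin g) (+-suc (suc (f zero)) _)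
  (+-mono-≤ fi<gi (sumFin-mono-< (λ l → f≤g (suc l)) j fj<gj))
sumFin-mono-<₂ {suc n} {f} {g} f≤g (suc i) zero _ fi<gi fj<gj = subst (_≤ sumFin g) (+-suc (suc (f zero)) _)
  (+-mono-≤ fj<gj (sumFin-mono-< (λ l → f≤g (suc l)) i fi<gi))
sumFin-mono-<₂ {suc n} {f} {g} f≤g (suc i) (suc j) i≢j fi<gi fj<gj =
  subst (_≤ sumFin g) (trans (+-suc (f zero) _) (cong suc (+-suc (f zero) _)))
    (+-mono-≤ (f≤g zero) (sumFin-mono-<₂ (λ l → f≤g (suc l)) i j (λ eq → i≢j (cong suc eq)) fi<gi fj<gj))

sumFin-<⇒∃< : sumFin f < sumFin g → ∃[ i ] (f i < g i)
sumFin-<⇒∃< {suc n} {f} {g} sum< with f zero <? g zero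
... | yes f0<g0 = zero , f0<g0
... | no f0≮g0 with sumFin-<⇒∃< {n} {λ i → f (suc i)} {λ i → g (suc i)}
                      (+-cancelˡ-< (g zero) _ _ (≤-<-trans (+-monoˡ-≤ _ (≮⇒≥ f0≮g0)) sum<))
...   | i , fi<gi = suc i , fi<gi

sumFin-indicator≤1 : ∀ (j : Fin n) → sumFin (λ i → if does (i ≟ j) then 1 else 0) ≤ 1
sumFin-indicator≤1 {suc n} zero    = s≤s (≤-reflexive (sumFin-zero n))
  where
  sumFin-zero : ∀ n → sumFin {n} (λ _ → 0) ≡ 0
  sumFin-zero zero    = refl
  sumFin-zero (suc n) = sumFin-zero n
sumFin-indicator≤1 {suc n} (suc j) = sumFin-indicator≤1 j

module Rank {n : ℕ} (Q : Multimatroid n) where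
  open Multimatroid Q

  Subtransversal : Subset n → Set
  Subtransversal = IsSubtransversal cls

  Spans : Subset n → Fin n → Set
  Spans A x = r (A ∪⁅ x ⁆) ≡ r A

  subtransversal? : ∀ A → Dec (Subtransversal A)
  subtransversal? A = all? λ x → all? λ y → x ∈? A →-dec y ∈? A →-dec cls x ≟ cls y →-dec x ≟ y

  subtransversal-⊥ : Subtransversal ⊥
  subtransversal-⊥ _ _ x∈⊥ = ⊥-elim (∉⊥ x∈⊥)

  subtransversal-⊆ : ∀ {A B} → A ⊆ B → Subtransversal B → Subtransversal A
  subtransversal-⊆ A⊆B st x y x∈A y∈A = st x y (A⊆B x∈A) (A⊆B y∈A)

  subtransversal-∪⁅⁆ : ∀ {A x} → Subtransversal A → ClassAvoids cls (cls x) A →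
                       Subtransversal (A ∪⁅ x ⁆)
  subtransversal-∪⁅⁆ {A} st avoids y z y∈ z∈ eq with y∈p∪⁅x⁆⁻ y∈ | y∈p∪⁅x⁆⁻ z∈
  ... | inj₁ y∈A  | inj₁ z∈A  = st y z y∈A z∈A eq
  ... | inj₁ y∈A  | inj₂ refl = ⊥-elim (avoids y y∈A eq)
  ... | inj₂ refl | inj₁ z∈A  = ⊥-elim (avoids z z∈A (sym eq))
  ... | inj₂ refl | inj₂ refl = refl

  classAvoids-⊆ : ∀ {A B c} → A ⊆ B → ClassAvoids cls c B → ClassAvoids cls c A
  classAvoids-⊆ A⊆B avoids y y∈A = avoids y (A⊆B y∈A)

  classAvoids-∪⁅⁆ : ∀ {A c y} → ClassAvoids cls c A → cls y ≢ c → ClassAvoids cls c (A ∪⁅ y ⁆)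
  classAvoids-∪⁅⁆ avoids cy≢c z z∈ with y∈p∪⁅x⁆⁻ z∈
  ... | inj₁ z∈A  = avoids z z∈A
  ... | inj₂ refl = cy≢c

  subtransversal⇒classAvoids : ∀ {A B x} → Subtransversal B → A ⊆ B → x ∈ B → x ∉ A →
                               ClassAvoids cls (cls x) A
  subtransversal⇒classAvoids st A⊆B x∈B x∉A y y∈A eq with st _ _ (A⊆B y∈A) x∈B eq
  ... | refl = x∉A y∈A

  r≤r-∪⁅⁆ : ∀ {A x} → Subtransversal A → ClassAvoids cls (cls x) A → r A ≤ r (A ∪⁅ x ⁆)
  r≤r-∪⁅⁆ {A} {x} st avoids = proj₁ (r-unit A x st avoids)

  r-∪⁅⁆≤1+r : ∀ {A x} → Subtransversal A → ClassAvoids cls (cls x) A → r (A ∪⁅ x ⁆) ≤ suc (r A)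
  r-∪⁅⁆≤1+r {A} {x} st avoids = proj₂ (r-unit A x st avoids)

  spans⊎r-∪⁅⁆≡1+r : ∀ {A x} → Subtransversal A → ClassAvoids cls (cls x) A →
                     Spans A x ⊎ r (A ∪⁅ x ⁆) ≡ suc (r A)
  spans⊎r-∪⁅⁆≡1+r st avoids with m≤n⇒m<n∨m≡n (r-∪⁅⁆≤1+r st avoids)
  ... | inj₁ (s≤s r∪x≤r) = inj₁ (≤-antisym r∪x≤r (r≤r-∪⁅⁆ st avoids))
  ... | inj₂ r∪x≡1+r     = inj₂ r∪x≡1+r

  r-mono : ∀ {A B} → A ⊆ B → Subtransversal B → r A ≤ r B
  r-mono {A} {B} A⊆B st = go B (⊂-wellFounded B) A⊆B st
    where
    go : ∀ B → Acc _⊂_ B → A ⊆ B → Subtransversal B → r A ≤ r B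
    go B (acc rec) A⊆B st with ⊆⇒≡⊎⊂ A⊆B
    ... | inj₁ refl = ≤-refl
    ... | inj₂ (_ , x , x∈B , x∉A) = begin
      r A               ≤⟨ go (B - x) (rec (x∈p⇒p-x⊂p x∈B)) (p⊆q∧x∉p⇒p⊆q-x A⊆B x∉A) st-B-x ⟩
      r (B - x)         ≤⟨ r≤r-∪⁅⁆ st-B-x (subtransversal⇒classAvoids st p-x⊆p x∈B x∉p-x) ⟩
      r (B - x ∪⁅ x ⁆)  ≡⟨ cong r (p-x∪⁅x⁆≡p x∈B) ⟩
      r B               ∎
      where
      open ≤-Reasoning
      st-B-x = subtransversal-⊆ p-x⊆p st

  r-growth≤∣∣-growth : ∀ {A B} → A ⊆ B → Subtransversal B → r B + ∣ A ∣ ≤ r A + ∣ B ∣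
  r-growth≤∣∣-growth {A} {B} A⊆B st = go B (⊂-wellFounded B) A⊆B st
    where
    go : ∀ B → Acc _⊂_ B → A ⊆ B → Subtransversal B → r B + ∣ A ∣ ≤ r A + ∣ B ∣
    go B (acc rec) A⊆B st with ⊆⇒≡⊎⊂ A⊆B
    ... | inj₁ refl = ≤-refl
    ... | inj₂ (_ , x , x∈B , x∉A) = begin
      r B + ∣ A ∣                  ≡⟨ cong (λ C → r C + ∣ A ∣) (sym (p-x∪⁅x⁆≡p x∈B)) ⟩
      r (B - x ∪⁅ x ⁆) + ∣ A ∣     ≤⟨ +-monoˡ-≤ ∣ A ∣ (r-∪⁅⁆≤1+r st-B-x
                                        (subtransversal⇒classAvoids st p-x⊆p x∈B x∉p-x)) ⟩
      suc (r (B - x) + ∣ A ∣)      ≤⟨ s≤s (go (B - x) (rec (x∈p⇒p-x⊂p x∈B))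
                                            (p⊆q∧x∉p⇒p⊆q-x A⊆B x∉A) st-B-x) ⟩
      suc (r A + ∣ B - x ∣)        ≡⟨ sym (+-suc (r A) _) ⟩
      r A + suc ∣ B - x ∣          ≡⟨ cong (r A +_) (sym (∣p∣≡1+∣p-x∣ x∈B)) ⟩
      r A + ∣ B ∣                  ∎
      where
      open ≤-Reasoning
      st-B-x = subtransversal-⊆ p-x⊆p st

  r≤∣∣ : ∀ {A} → Subtransversal A → r A ≤ ∣ A ∣
  r≤∣∣ {A} st = begin
    r A              ≡⟨ sym (+-identityʳ (r A)) ⟩
    r A + 0          ≡⟨ cong (r A +_) (sym (∣⊥∣≡0 n)) ⟩
    r A + ∣ ⊥ {n} ∣  ≤⟨ r-growth≤∣∣-growth ⊥⊆ st ⟩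
    r ⊥ + ∣ A ∣      ≡⟨ cong (_+ ∣ A ∣) r-empty ⟩
    ∣ A ∣            ∎
    where open ≤-Reasoning

  independent-⊆ : ∀ {A B} → A ⊆ B → Subtransversal B → IsIndependent Q B → IsIndependent Q A
  independent-⊆ {A} {B} A⊆B st rB≡∣B∣ = ≤-antisym (r≤∣∣ (subtransversal-⊆ A⊆B st))
    (+-cancelˡ-≤ ∣ B ∣ ∣ A ∣ (r A) (begin
      ∣ B ∣ + ∣ A ∣   ≡⟨ cong (_+ ∣ A ∣) (sym rB≡∣B∣) ⟩
      r B + ∣ A ∣     ≤⟨ r-growth≤∣∣-growth A⊆B st ⟩
      r A + ∣ B ∣     ≡⟨ +-comm (r A) ∣ B ∣ ⟩
      ∣ B ∣ + r A     ∎))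
    where open ≤-Reasoning

  r-subadditive : ∀ P R → Subtransversal (P ∪ R) → r (P ∪ R) ≤ r P + r R
  r-subadditive P R st = ≤-trans (m≤m+n (r (P ∪ R)) (r (P ∩ R))) (r-submod P R st)

  r-submodular-∪⁅⁆ : ∀ {A B z} → A ⊆ B → Subtransversal (B ∪⁅ z ⁆) → z ∉ B →
                     r (B ∪⁅ z ⁆) + r A ≤ r B + r (A ∪⁅ z ⁆)
  r-submodular-∪⁅⁆ {A} {B} {z} A⊆B st z∉B = begin
    r (B ∪⁅ z ⁆) + r A                        ≡⟨ cong₂ (λ C D → r C + r D) (sym ∪-eq) (sym ∩-eq) ⟩
    r ((A ∪⁅ z ⁆) ∪ B) + r ((A ∪⁅ z ⁆) ∩ B)   ≤⟨ r-submod (A ∪⁅ z ⁆) B (subst Subtransversal (sym ∪-eq) st) ⟩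
    r (A ∪⁅ z ⁆) + r B                        ≡⟨ +-comm (r (A ∪⁅ z ⁆)) (r B) ⟩
    r B + r (A ∪⁅ z ⁆)                        ∎
    where
    open ≤-Reasoning
    ∪-eq = p⊆q⇒[p∪⁅x⁆]∪q≡q∪⁅x⁆ A⊆B
    ∩-eq = trans (x∉q⇒[p∪⁅x⁆]∩q≡p∩q z∉B) (p⊆q⇒p∩q≡p A⊆B)

  spans-⊆ : ∀ {A B z} → A ⊆ B → Subtransversal (B ∪⁅ z ⁆) → z ∉ B → Spans A z → Spans B z
  spans-⊆ {A} {B} {z} A⊆B st z∉B A-spans = ≤-antisym
    (+-cancelʳ-≤ (r A) (r (B ∪⁅ z ⁆)) (r B)
      (subst (λ t → r (B ∪⁅ z ⁆) + r A ≤ r B + t) A-spans (r-submodular-∪⁅⁆ A⊆B st z∉B)))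
    (r-mono p⊆p∪⁅x⁆ st)

  spans-trans : ∀ {U a x} → Subtransversal (U ∪⁅ a ⁆ ∪⁅ x ⁆) → ClassAvoids cls (cls x) U →
                Spans U a → Spans (U ∪⁅ a ⁆) x → Spans U x
  spans-trans {U} {a} {x} st avoids a-spanned x-spanned = ≤-antisym (begin
    r (U ∪⁅ x ⁆)           ≤⟨ r-mono (∪⁅⁆-mono p⊆p∪⁅x⁆) st ⟩
    r (U ∪⁅ a ⁆ ∪⁅ x ⁆)    ≡⟨ x-spanned ⟩
    r (U ∪⁅ a ⁆)           ≡⟨ a-spanned ⟩
    r U                    ∎)
    (r≤r-∪⁅⁆ (subtransversal-⊆ (λ m → p⊆p∪⁅x⁆ (p⊆p∪⁅x⁆ m)) st) avoids)
    where open ≤-Reasoning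

  r≤1+r[D-x] : ∀ {D x} → Subtransversal D → x ∈ D → r D ≤ suc (r (D - x))
  r≤1+r[D-x] {D} {x} st x∈D = subst (λ C → r C ≤ suc (r (D - x))) (p-x∪⁅x⁆≡p x∈D)
    (r-∪⁅⁆≤1+r (subtransversal-⊆ p-x⊆p st) (subtransversal⇒classAvoids st p-x⊆p x∈D x∉p-x))

  coloop-of-D⇒coloop-of-D-x : ∀ {D x y} → Subtransversal D → y ∈ D - x → r (D - y) < r D →
                              r (D - x - y) < r (D - x)
  coloop-of-D⇒coloop-of-D-x {D} {x} {y} st y∈D-x y-coloop = +-cancelˡ-< (r (D - y)) _ _ (begin
    suc (r (D - y) + r (D - x - y))   ≤⟨ +-monoˡ-≤ (r (D - x - y)) y-coloop ⟩
    r D + r (D - x - y)               ≡⟨ cong (λ C → r C + r (D - x - y)) (sym (p-x∪⁅x⁆≡p y∈D)) ⟩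
    r (D - y ∪⁅ y ⁆) + r (D - x - y)  ≤⟨ r-submodular-∪⁅⁆ p-x-y⊆p-y
                                           (subst Subtransversal (sym (p-x∪⁅x⁆≡p y∈D)) st) x∉p-x ⟩
    r (D - y) + r (D - x - y ∪⁅ y ⁆)  ≡⟨ cong (λ C → r (D - y) + r C) (p-x∪⁅x⁆≡p y∈D-x) ⟩
    r (D - y) + r (D - x)             ∎)
    where
    open ≤-Reasoning
    y∈D = p-x⊆p y∈D-x

  coloops⇒independent : ∀ {D} → Subtransversal D → (∀ x → x ∈ D → r (D - x) < r D) →
                        IsIndependent Q D
  coloops⇒independent {D} = go D (⊂-wellFounded D)
    where
    go : ∀ D → Acc _⊂_ D → Subtransversal D → (∀ x → x ∈ D → r (D - x) < r D) →
         IsIndependent Q D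
    go D (acc rec) st coloop with nonempty? D
    ... | no empty rewrite Empty-unique empty = trans r-empty (sym (∣⊥∣≡0 n))
    ... | yes (x , x∈D) = begin
      r D               ≡⟨ ≤-antisym (r≤1+r[D-x] st x∈D) (coloop x x∈D) ⟩
      suc (r (D - x))   ≡⟨ cong suc (go (D - x) (rec (x∈p⇒p-x⊂p x∈D)) (subtransversal-⊆ p-x⊆p st)
                             (λ y y∈D-x → coloop-of-D⇒coloop-of-D-x st y∈D-x (coloop y (p-x⊆p y∈D-x)))) ⟩
      suc ∣ D - x ∣     ≡⟨ sym (∣p∣≡1+∣p-x∣ x∈D) ⟩
      ∣ D ∣             ∎
      where open ≡-Reasoning

  minimal-spanning⇒circuit : ∀ {D e} → Subtransversal (D ∪⁅ e ⁆) → e ∉ D → Spans D e →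
                             (∀ x → x ∈ D → ¬ Spans (D - x) e) → IsCircuit Q (D ∪⁅ e ⁆)
  minimal-spanning⇒circuit {D} {e} st e∉D D-spans minimal = st , dependent , proper⇒independent
    where
    st-D = subtransversal-⊆ p⊆p∪⁅x⁆ st
    st-D-x∪e : ∀ x → Subtransversal (D - x ∪⁅ e ⁆)
    st-D-x∪e x = subtransversal-⊆ (∪⁅⁆-mono p-x⊆p) st

    D-x-raises : ∀ x → x ∈ D → r (D - x ∪⁅ e ⁆) ≡ suc (r (D - x))
    D-x-raises x x∈D with spans⊎r-∪⁅⁆≡1+r (subtransversal-⊆ p-x⊆p st-D)
      (subtransversal⇒classAvoids st (λ m → p⊆p∪⁅x⁆ (p-x⊆p m)) x∈p∪⁅x⁆ (λ m → e∉D (p-x⊆p m)))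
    ... | inj₁ spans = ⊥-elim (minimal x x∈D spans)
    ... | inj₂ raises = raises

    D-independent : IsIndependent Q D
    D-independent = coloops⇒independent st-D λ x x∈D → begin-strict
      r (D - x)           <⟨ n<1+n (r (D - x)) ⟩
      suc (r (D - x))     ≡⟨ sym (D-x-raises x x∈D) ⟩
      r (D - x ∪⁅ e ⁆)    ≤⟨ r-mono (∪⁅⁆-mono p-x⊆p) st ⟩
      r (D ∪⁅ e ⁆)        ≡⟨ D-spans ⟩
      r D                 ∎
      where open ≤-Reasoning

    dependent : ¬ IsIndependent Q (D ∪⁅ e ⁆)
    dependent r≡∣∣ = 1+n≢n (begin
      suc ∣ D ∣           ≡⟨ sym (∣p∪⁅x⁆∣≡1+∣p∣ e∉D) ⟩
      ∣ D ∪⁅ e ⁆ ∣        ≡⟨ sym r≡∣∣ ⟩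
      r (D ∪⁅ e ⁆)        ≡⟨ D-spans ⟩
      r D                 ≡⟨ D-independent ⟩
      ∣ D ∣               ∎)
      where open ≡-Reasoning

    D-x∪e-independent : ∀ x → x ∈ D → IsIndependent Q (D - x ∪⁅ e ⁆)
    D-x∪e-independent x x∈D = begin
      r (D - x ∪⁅ e ⁆)    ≡⟨ D-x-raises x x∈D ⟩
      suc (r (D - x))     ≡⟨ cong suc (independent-⊆ p-x⊆p st-D D-independent) ⟩
      suc ∣ D - x ∣       ≡⟨ sym (∣p∪⁅x⁆∣≡1+∣p∣ {p = D - x} (λ m → e∉D (p-x⊆p m))) ⟩
      ∣ D - x ∪⁅ e ⁆ ∣    ∎
      where open ≡-Reasoning

    proper⇒independent : ∀ C → C ⊆ D ∪⁅ e ⁆ → C ≢ D ∪⁅ e ⁆ → IsIndependent Q C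
    proper⇒independent C C⊆ C≢ with ⊆⇒≡⊎⊂ C⊆
    ... | inj₁ C≡ = ⊥-elim (C≢ C≡)
    ... | inj₂ (_ , y , y∈ , y∉C) with y∈p∪⁅x⁆⁻ y∈
    ...   | inj₂ refl = independent-⊆ (p⊆q∪⁅x⁆∧x∉p⇒p⊆q C⊆ y∉C) st-D D-independent
    ...   | inj₁ y∈D  = independent-⊆ (p⊆q∪⁅x⁆∧y∉p⇒p⊆q-y∪⁅x⁆ C⊆ y∉C) (st-D-x∪e y)
                          (D-x∪e-independent y y∈D)

  spans⇒circuit : ∀ {D e} → Subtransversal (D ∪⁅ e ⁆) → e ∉ D → Spans D e →
                  ∃[ C ] (IsCircuit Q C × e ∈ C × C ⊆ D ∪⁅ e ⁆)
  spans⇒circuit {D} {e} = go D (⊂-wellFounded D)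
    where
    go : ∀ D → Acc _⊂_ D → Subtransversal (D ∪⁅ e ⁆) → e ∉ D → Spans D e →
         ∃[ C ] (IsCircuit Q C × e ∈ C × C ⊆ D ∪⁅ e ⁆)
    go D (acc rec) st e∉D D-spans with any? (λ x → x ∈? D ×-dec (r (D - x ∪⁅ e ⁆) ≟ℕ r (D - x)))
    ... | no none = D ∪⁅ e ⁆ ,
          minimal-spanning⇒circuit st e∉D D-spans (λ x x∈D spans → none (x , x∈D , spans)) ,
          x∈p∪⁅x⁆ , (λ m → m)
    ... | yes (x , x∈D , D-x-spans) with go (D - x) (rec (x∈p⇒p-x⊂p x∈D))
                                            (subtransversal-⊆ (∪⁅⁆-mono p-x⊆p) st)
                                            (λ m → e∉D (p-x⊆p m)) D-x-spans
    ...   | C , circuit , e∈C , C⊆ = C , circuit , e∈C , (λ m → ∪⁅⁆-mono p-x⊆p (C⊆ m))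

  r-additive-⊆ˡ : ∀ {P P′ R} → P′ ⊆ P → P ∩ R ≡ ⊥ → Subtransversal (P ∪ R) →
                  r P + r R ≤ r (P ∪ R) → r P′ + r R ≤ r (P′ ∪ R)
  r-additive-⊆ˡ {P} {P′} {R} P′⊆P P∩R≡⊥ st additive = +-cancelˡ-≤ (r P) _ _ (begin
    r P + (r P′ + r R)              ≡⟨ +-comm (r P) _ ⟩
    r P′ + r R + r P                ≡⟨ +-assoc (r P′) (r R) (r P) ⟩
    r P′ + (r R + r P)              ≡⟨ cong (r P′ +_) (+-comm (r R) (r P)) ⟩
    r P′ + (r P + r R)              ≤⟨ +-monoʳ-≤ (r P′) additive ⟩
    r P′ + r (P ∪ R)                ≡⟨ +-comm (r P′) _ ⟩
    r (P ∪ R) + r P′                ≡⟨ cong₂ (λ C D → r C + r D) (sym ∪-eq) (sym ∩-eq) ⟩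
    r (P ∪ (P′ ∪ R)) + r (P ∩ (P′ ∪ R))  ≤⟨ r-submod P (P′ ∪ R) (subst Subtransversal (sym ∪-eq) st) ⟩
    r P + r (P′ ∪ R)                ∎)
    where
    open ≤-Reasoning
    ∪-eq : P ∪ (P′ ∪ R) ≡ P ∪ R
    ∪-eq = trans (sym (∪-assoc P P′ R)) (cong (_∪ R) (trans (∪-comm P P′) (p⊆q⇒p∪q≡q P′⊆P)))
    ∩-eq : P ∩ (P′ ∪ R) ≡ P′
    ∩-eq = trans (∩-distribˡ-∪ P P′ R)
      (trans (cong₂ _∪_ (trans (∩-comm P P′) (p⊆q⇒p∩q≡p P′⊆P)) P∩R≡⊥) (∪-identityʳ P′))

  r-additive-⊆ : ∀ {P P′ R R′} → P′ ⊆ P → R′ ⊆ R → P ∩ R ≡ ⊥ → Subtransversal (P ∪ R) →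
                 r P + r R ≤ r (P ∪ R) → r P′ + r R′ ≤ r (P′ ∪ R′)
  r-additive-⊆ {P} {P′} {R} {R′} P′⊆P R′⊆R P∩R≡⊥ st additive =
    subst₂ (λ s C → s ≤ r C) (+-comm (r R′) (r P′)) (∪-comm R′ P′)
      (r-additive-⊆ˡ R′⊆R (trans (∩-comm R P′) P′∩R≡⊥) (subst Subtransversal (∪-comm P′ R) st-P′∪R)
        (subst₂ (λ s C → s ≤ r C) (+-comm (r P′) (r R)) (∪-comm P′ R)
          (r-additive-⊆ˡ P′⊆P P∩R≡⊥ st additive)))
    where
    P′∩R≡⊥ = p⊆q∧q∩s≡⊥⇒p∩s≡⊥ P′⊆P P∩R≡⊥
    st-P′∪R = subtransversal-⊆ (p⊆q⇒p∪s⊆q∪s P′⊆P) st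

  Splits : Subset n → Subset n → Set
  Splits X S = r S ≡ r (S ∩ X) + r (S ─ X)

  r≤r∩+r─ : ∀ X {S} → Subtransversal S → r S ≤ r (S ∩ X) + r (S ─ X)
  r≤r∩+r─ X {S} st = subst (λ C → r C ≤ r (S ∩ X) + r (S ─ X)) ([p∩q]∪[p─q]≡p S X)
    (r-subadditive (S ∩ X) (S ─ X) (subst Subtransversal (sym ([p∩q]∪[p─q]≡p S X)) st))

  splits-⊆ : ∀ X {S T} → S ⊆ T → Subtransversal T → Splits X T → Splits X S
  splits-⊆ X {S} {T} S⊆T st T-splits = ≤-antisym (r≤r∩+r─ X (subtransversal-⊆ S⊆T st))
    (subst (λ C → r (S ∩ X) + r (S ─ X) ≤ r C) ([p∩q]∪[p─q]≡p S X)
      (r-additive-⊆ (p⊆q⇒p∩s⊆q∩s S⊆T) (p⊆q⇒p─s⊆q─s S⊆T) ([p∩q]∩[p─q]≡⊥ T X)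
        (subst Subtransversal (sym ([p∩q]∪[p─q]≡p T X)) st)
        (subst (λ C → r (T ∩ X) + r (T ─ X) ≤ r C) (sym ([p∩q]∪[p─q]≡p T X)) (≤-reflexive (sym T-splits)))))

module Classes {n : ℕ} (Q : Multimatroid n) where
  open Multimatroid Q
  open Rank Q

  Meets : Subset n → Fin k → Set
  Meets S c = ∃[ y ] (y ∈ S × cls y ≡ c)

  meets? : ∀ S c → Dec (Meets S c)
  meets? S c = any? (λ y → y ∈? S ×-dec cls y ≟ c)

  unmet⇒avoids : ∀ {A c} → ¬ Meets A c → ClassAvoids cls c A
  unmet⇒avoids unmet y y∈A cy≡c = unmet (y , y∈A , cy≡c)

  record Extension (S : Subset n) (P : Fin k → Set) : Set where
    field
      T          : Subset n
      S⊆T        : S ⊆ T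
      T-st       : Subtransversal T
      T-new      : ∀ {y} → y ∈ T → y ∈ S ⊎ P (cls y)
      T-meets    : ∀ c → P c → Meets T c

  extend : ∀ {P S} → (∀ c → Dec (P c)) → Subtransversal S → Extension S P
  extend {P} {S} P? st = go S (⊃-wellFounded S) ⊆-refl inj₁ st
    where
    go : ∀ T → Acc _⊃_ T → S ⊆ T → (∀ {y} → y ∈ T → y ∈ S ⊎ P (cls y)) → Subtransversal T →
         Extension S P
    go T (acc rec) S⊆T T-new T-st with any? (λ c → P? c ×-dec ¬? (meets? T c))
    ... | no none = record { T = T ; S⊆T = S⊆T ; T-st = T-st ; T-new = T-new ; T-meets = T-meets }
      where
      T-meets : ∀ c → P c → Meets T c
      T-meets c Pc with meets? T c
      ... | yes meets = meets
      ... | no unmet  = ⊥-elim (none (c , Pc , unmet))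
    ... | yes (c , Pc , unmet) with cls-surj c
    ...   | a , ca≡c = go (T ∪⁅ a ⁆) (rec (x∉p⇒p⊂p∪⁅x⁆ (λ a∈T → unmet (a , a∈T , ca≡c))))
                         (λ m → p⊆p∪⁅x⁆ (S⊆T m)) T∪a-new (subtransversal-∪⁅⁆ T-st avoids)
      where
      avoids : ClassAvoids cls (cls a) T
      avoids y y∈T cy≡ca = unmet (y , y∈T , trans cy≡ca ca≡c)
      T∪a-new : ∀ {y} → y ∈ T ∪⁅ a ⁆ → y ∈ S ⊎ P (cls y)
      T∪a-new m with y∈p∪⁅x⁆⁻ m
      ... | inj₁ y∈T  = T-new y∈T
      ... | inj₂ refl = inj₂ (subst P (sym ca≡c) Pc)

module Tight {n : ℕ} (Q : Multimatroid n) (tight : IsTight Q) where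
  open Multimatroid Q
  open Rank Q
  open Classes Q

  indicator : Fin k → Fin n → ℕ
  indicator c x = if does (cls x ≟ c) then 1 else 0

  gain : Subset n → Fin k → Fin n → ℕ
  gain A c x = if does (cls x ≟ c) then r (A ∪⁅ x ⁆) ∸ r A else 0

  gain≤indicator : ∀ {A c} → Subtransversal A → ClassAvoids cls c A → ∀ x → gain A c x ≤ indicator c x
  gain≤indicator {A} {c} st avoids x with cls x ≟ c
  ... | yes refl = ≤-trans (∸-monoˡ-≤ (r A) (r-∪⁅⁆≤1+r st avoids)) (≤-reflexive (m+n∸n≡m 1 (r A)))
  ... | no _     = z≤n

  gain<indicator⇒spans : ∀ {A c} → Subtransversal A → ClassAvoids cls c A →
                         ∀ x → gain A c x < indicator c x → cls x ≡ c × Spans A x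
  gain<indicator⇒spans {A} {c} st avoids x gain<1 with cls x ≟ c
  ... | yes refl = refl , ≤-antisym (m∸n≡0⇒m≤n (n<1⇒n≡0 gain<1)) (r≤r-∪⁅⁆ st avoids)
  ... | no _     = ⊥-elim (n≮0 gain<1)

  spans⇒gain<indicator : ∀ {A c x} → cls x ≡ c → Spans A x → gain A c x < indicator c x
  spans⇒gain<indicator {A} {c} {x} cx≡c spans with cls x ≟ c
  ... | yes _     = subst (λ t → t ∸ r A < 1) (sym spans) (≤-reflexive (cong suc (n∸n≡0 (r A))))
  ... | no cx≢c   = ⊥-elim (cx≢c cx≡c)

  spanned-exists : ∀ {T c} → Subtransversal T → ClassAvoids cls c T →
                   (∀ c′ → c′ ≢ c → Meets T c′) → ∃[ x ] (cls x ≡ c × Spans T x)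
  spanned-exists {T} {c} st avoids meets with sumFin-<⇒∃< {f = gain T c} {g = indicator c} sum<
    where
    sum< : sumFin (gain T c) < sumFin (indicator c)
    sum< = subst (_< classSize cls c) (sym (proj₂ tight c T st avoids meets))
      (∸-monoʳ-< {o = 0} (s≤s z≤n) (≤-trans (s≤s z≤n) (proj₁ tight c)))
  ... | x , gain<1 = x , gain<indicator⇒spans st avoids x gain<1

  spans-unique : ∀ {S x x′} → Subtransversal S → ClassAvoids cls (cls x) S → cls x′ ≡ cls x →
                 Spans S x → Spans S x′ → x ≡ x′
  spans-unique {S} {x} {x′} st avoids cx′≡cx x-spanned x′-spanned with x ≟ x′
  ... | yes x≡x′ = x≡x′
  ... | no x≢x′  = ⊥-elim (2+[m∸1]≰m
        (subst (λ s → 2 + s ≤ classSize cls (cls x)) (proj₂ tight (cls x) T T-st T-avoids T-meets)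
          (sumFin-mono-<₂ (gain≤indicator T-st T-avoids) x x′ x≢x′
            (spans⇒gain<indicator refl (spanned-in-T refl x-spanned))
            (spans⇒gain<indicator cx′≡cx (spanned-in-T cx′≡cx x′-spanned)))))
    where
    open Extension (extend (λ c → ¬? (c ≟ cls x)) st)
    T-avoids : ClassAvoids cls (cls x) T
    T-avoids y y∈T with T-new y∈T
    ... | inj₁ y∈S   = avoids y y∈S
    ... | inj₂ cy≢cx = cy≢cx
    spanned-in-T : ∀ {w} → cls w ≡ cls x → Spans S w → Spans T w
    spanned-in-T {w} cw≡cx = spans-⊆ S⊆T
      (subtransversal-∪⁅⁆ T-st (subst (λ c → ClassAvoids cls c T) (sym cw≡cx) T-avoids))
      (λ w∈T → T-avoids w w∈T cw≡cx)
    2+[m∸1]≰m : ∀ {m} → ¬ (2 + (m ∸ 1) ≤ m)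
    2+[m∸1]≰m {zero}  ()
    2+[m∸1]≰m {suc m} (s≤s le) = n≮n m le

  skewPartner : ∀ z → ∃[ y ] (y ≢ z × cls y ≡ cls z)
  skewPartner z with sumFin-<⇒∃< {f = λ y → if does (y ≟ z) then 1 else 0} {g = indicator (cls z)}
                       (≤-trans (s≤s (sumFin-indicator≤1 z)) (proj₁ tight (cls z)))
  ... | y , δ<indicator = y , partner y δ<indicator
    where
    partner : ∀ y → (if does (y ≟ z) then 1 else 0) < indicator (cls z) y → y ≢ z × cls y ≡ cls z
    partner y lt with y ≟ z | cls y ≟ cls z
    ... | _       | no _        = ⊥-elim (n≮0 lt)
    ... | yes _   | yes _       = ⊥-elim (n≮n 1 lt)
    ... | no y≢z  | yes cy≡cz   = y≢z , cy≡cz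

  spans-of-all-extensions : ∀ {U x z} → Subtransversal U → ClassAvoids cls (cls x) U →
                            ClassAvoids cls (cls z) (U ∪⁅ x ⁆) →
                            (∀ y → cls y ≡ cls z → Spans (U ∪⁅ y ⁆) x) → Spans U x
  spans-of-all-extensions {U} {x} {z} st x-avoids z-avoids x-spanned with spans⊎r-∪⁅⁆≡1+r st x-avoids
  ... | inj₁ spans  = spans
  ... | inj₂ raises with skewPartner z
  ...   | y , y≢z , cy≡cz = ⊥-elim (y≢z (sym (spans-unique st-Ux z-avoids cy≡cz
                                             (class-spanned refl) (class-spanned cy≡cz))))
    where
    st-Ux = subtransversal-∪⁅⁆ st x-avoids
    class-spanned : ∀ {w} → cls w ≡ cls z → Spans (U ∪⁅ x ⁆) w
    class-spanned {w} cw≡cz = ≤-antisym (begin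
      r (U ∪⁅ x ⁆ ∪⁅ w ⁆)   ≡⟨ cong r ∪⁅⁆-comm ⟩
      r (U ∪⁅ w ⁆ ∪⁅ x ⁆)   ≡⟨ x-spanned w cw≡cz ⟩
      r (U ∪⁅ w ⁆)          ≤⟨ r-∪⁅⁆≤1+r st (classAvoids-⊆ p⊆p∪⁅x⁆ w-avoids) ⟩
      suc (r U)             ≡⟨ sym raises ⟩
      r (U ∪⁅ x ⁆)          ∎)
      (r≤r-∪⁅⁆ st-Ux w-avoids)
      where
      open ≤-Reasoning
      w-avoids = subst (λ c → ClassAvoids cls c (U ∪⁅ x ⁆)) (sym cw≡cz) z-avoids

module MinorSeparator {n : ℕ} (Q : Multimatroid n) (e : Fin n) (X : Subset n)
                      (X-separates : Minor.IsSeparator Q ⁅ e ⁆ X) where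
  open Multimatroid Q
  open Rank Q

  ω : Fin k
  ω = cls e

  X-avoids-ω : ∀ {x} → x ∈ X → cls x ≢ ω
  X-avoids-ω {x} x∈X cx≡ω = proj₁ (proj₁ X-separates) x x∈X e (x∈⁅x⁆ e) (sym cx≡ω)

  X-closed : ∀ {x y} → x ∈ X → cls y ≡ cls x → y ∈ X
  X-closed {x} {y} x∈X cy≡cx = proj₂ (proj₁ X-separates) x y x∈X y-avoids-e (sym cy≡cx)
    where
    y-avoids-e : ClassAvoids cls (cls y) ⁅ e ⁆
    y-avoids-e w w∈⁅e⁆ cw≡cy rewrite x∈⁅y⁆⇒x≡y e w∈⁅e⁆ = X-avoids-ω x∈X (sym (trans cw≡cy cy≡cx))

  e∉X : e ∉ X
  e∉X e∈X = X-avoids-ω e∈X refl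

  ω-avoids-⊆X : ∀ {A} → A ⊆ X → ClassAvoids cls ω A
  ω-avoids-⊆X A⊆X y y∈A = X-avoids-ω (A⊆X y∈A)

  circuit-in-X : ∀ {A} → A ⊆ X → Subtransversal A → Spans A e →
                 ∃[ C ] (IsCircuit Q C × e ∈ C × C ⊆ X ∪ ⁅ e ⁆)
  circuit-in-X A⊆X st A-spans
    with spans⇒circuit (subtransversal-∪⁅⁆ st (ω-avoids-⊆X A⊆X)) (λ e∈A → e∉X (A⊆X e∈A)) A-spans
  ... | C , circuit , e∈C , C⊆A∪e = C , circuit , e∈C , (λ m → ∪⁅⁆-mono A⊆X (C⊆A∪e m))

module Separation {n : ℕ} (Q : Multimatroid n) (tight : IsTight Q) (e : Fin n) (X : Subset n)
                  (X-separates : Minor.IsSeparator Q ⁅ e ⁆ X)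
                  (e-raises : ∀ A → A ⊆ X → Rank.Subtransversal Q A →
                              Multimatroid.r Q (A ∪⁅ e ⁆) ≡ suc (Multimatroid.r Q A))
  where
  open Multimatroid Q
  open Rank Q
  open Classes Q
  open Tight Q tight
  open MinorSeparator Q e X X-separates

  r⁅e⁆≡1 : r ⁅ e ⁆ ≡ 1
  r⁅e⁆≡1 = begin
    r ⁅ e ⁆         ≡⟨ cong r (sym (∪-identityˡ ⁅ e ⁆)) ⟩
    r (⊥ ∪⁅ e ⁆)    ≡⟨ e-raises ⊥ ⊥⊆ subtransversal-⊥ ⟩
    suc (r ⊥)       ≡⟨ cong suc r-empty ⟩
    1               ∎
    where open ≡-Reasoning

  1≤r-∪⁅e⁆ : ∀ {A} → Subtransversal (A ∪⁅ e ⁆) → 1 ≤ r (A ∪⁅ e ⁆)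
  1≤r-∪⁅e⁆ {A} st = subst (_≤ r (A ∪⁅ e ⁆)) r⁅e⁆≡1 (r-mono (q⊆p∪q A ⁅ e ⁆) st)

  minor-splits : ∀ {S} → Subtransversal S → ClassAvoids cls ω S →
                 r (S ∪⁅ e ⁆) ≡ r (S ∩ X) + r (S ─ X ∪⁅ e ⁆)
  minor-splits {S} st ω-avoids = begin
    r (S ∪⁅ e ⁆)                                  ≡⟨ sym (m∸n+n≡m (1≤r-∪⁅e⁆ st-S∪e)) ⟩
    r (S ∪⁅ e ⁆) ∸ 1 + 1                          ≡⟨ cong (_+ 1) minor-equation ⟩
    r (S ∩ X) + (r (S ─ X ∪⁅ e ⁆) ∸ 1) + 1        ≡⟨ +-assoc (r (S ∩ X)) _ 1 ⟩
    r (S ∩ X) + (r (S ─ X ∪⁅ e ⁆) ∸ 1 + 1)        ≡⟨ cong (r (S ∩ X) +_) (m∸n+n≡m (1≤r-∪⁅e⁆ st-S─X∪e)) ⟩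
    r (S ∩ X) + r (S ─ X ∪⁅ e ⁆)                  ∎
    where
    open ≡-Reasoning
    st-S∪e = subtransversal-∪⁅⁆ st ω-avoids
    st-S─X∪e = subtransversal-∪⁅⁆ (subtransversal-⊆ (p─q⊆p S X) st) (classAvoids-⊆ (p─q⊆p S X) ω-avoids)
    in-minor : ∀ x → x ∈ S → ClassAvoids cls (cls x) ⁅ e ⁆
    in-minor x x∈S w w∈⁅e⁆ cw≡cx rewrite x∈⁅y⁆⇒x≡y e w∈⁅e⁆ = ω-avoids x x∈S (sym cw≡cx)
    minor-equation : r (S ∪⁅ e ⁆) ∸ 1 ≡ r (S ∩ X) + (r (S ─ X ∪⁅ e ⁆) ∸ 1)
    minor-equation = begin
      r (S ∪⁅ e ⁆) ∸ 1                                          ≡⟨ cong (r (S ∪⁅ e ⁆) ∸_) (sym r⁅e⁆≡1) ⟩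
      r (S ∪⁅ e ⁆) ∸ r ⁅ e ⁆                                    ≡⟨ proj₂ X-separates S (in-minor , st) ⟩
      r (S ∩ X ∪⁅ e ⁆) ∸ r ⁅ e ⁆ + (r (S ─ X ∪⁅ e ⁆) ∸ r ⁅ e ⁆) ≡⟨ cong₂ (λ t u → t ∸ u + (r (S ─ X ∪⁅ e ⁆) ∸ u))
                                                                      (e-raises (S ∩ X) (p∩q⊆q S X)
                                                                        (subtransversal-⊆ (p∩q⊆p S X) st))
                                                                      r⁅e⁆≡1 ⟩
      r (S ∩ X) + (r (S ─ X ∪⁅ e ⁆) ∸ 1)                        ∎

  avoiding-splits : ∀ {S} → Subtransversal S → ClassAvoids cls ω S → Splits X S
  avoiding-splits {S} st ω-avoids = ≤-antisym (r≤r∩+r─ X st)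
    (+-cancelʳ-≤ (r (S ─ X ∪⁅ e ⁆)) _ _ (begin
      r (S ∩ X) + r (S ─ X) + r (S ─ X ∪⁅ e ⁆)    ≡⟨ +-assoc (r (S ∩ X)) _ _ ⟩
      r (S ∩ X) + (r (S ─ X) + r (S ─ X ∪⁅ e ⁆))  ≡⟨ cong (r (S ∩ X) +_) (+-comm (r (S ─ X)) _) ⟩
      r (S ∩ X) + (r (S ─ X ∪⁅ e ⁆) + r (S ─ X))  ≡⟨ sym (+-assoc (r (S ∩ X)) _ _) ⟩
      r (S ∩ X) + r (S ─ X ∪⁅ e ⁆) + r (S ─ X)    ≡⟨ cong (_+ r (S ─ X)) (sym (minor-splits st ω-avoids)) ⟩
      r (S ∪⁅ e ⁆) + r (S ─ X)                    ≤⟨ r-submodular-∪⁅⁆ (p─q⊆p S X) (subtransversal-∪⁅⁆ st ω-avoids)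
                                                       (λ e∈S → ω-avoids e e∈S refl) ⟩
      r S + r (S ─ X ∪⁅ e ⁆)                      ∎))
    where open ≤-Reasoning

  module Spanning (B : Subset n) (st-B : Subtransversal B) (B-outside : ∀ {y} → y ∈ B → y ∉ X)
                  (ω-avoids-B : ClassAvoids cls ω B)
                  (B-meets : ∀ c → c ≢ ω → ¬ Meets X c → Meets B c) where

    st-B∪A : ∀ {A} → A ⊆ X → Subtransversal A → Subtransversal (B ∪ A)
    st-B∪A {A} A⊆X st x y x∈ y∈ cx≡cy with x∈p∪q⁻ B A x∈ | x∈p∪q⁻ B A y∈
    ... | inj₁ x∈B | inj₁ y∈B = st-B x y x∈B y∈B cx≡cy
    ... | inj₁ x∈B | inj₂ y∈A = ⊥-elim (B-outside x∈B (X-closed (A⊆X y∈A) cx≡cy))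
    ... | inj₂ x∈A | inj₁ y∈B = ⊥-elim (B-outside y∈B (X-closed (A⊆X x∈A) (sym cx≡cy)))
    ... | inj₂ x∈A | inj₂ y∈A = st x y x∈A y∈A cx≡cy

    ω-avoids-B∪A : ∀ {A} → A ⊆ X → ClassAvoids cls ω (B ∪ A)
    ω-avoids-B∪A {A} A⊆X y y∈ with x∈p∪q⁻ B A y∈
    ... | inj₁ y∈B = ω-avoids-B y y∈B
    ... | inj₂ y∈A = X-avoids-ω (A⊆X y∈A)

    unmet-avoids-B∪A : ∀ {A z} → z ∈ X → ¬ Meets A (cls z) → ClassAvoids cls (cls z) (B ∪ A)
    unmet-avoids-B∪A {A} z∈X unmet y y∈ cy≡cz with x∈p∪q⁻ B A y∈
    ... | inj₁ y∈B = B-outside y∈B (X-closed z∈X cy≡cz)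
    ... | inj₂ y∈A = unmet (y , y∈A , cy≡cz)

    [B∪A]∩X≡A : ∀ {A} → A ⊆ X → (B ∪ A) ∩ X ≡ A
    [B∪A]∩X≡A = disjoint∧q⊆s⇒[p∪q]∩s≡q B-outside

    [B∪A]─X≡B : ∀ {A} → A ⊆ X → (B ∪ A) ─ X ≡ B
    [B∪A]─X≡B = disjoint∧q⊆s⇒[p∪q]─s≡p B-outside

    r-B∪A : ∀ {A} → A ⊆ X → Subtransversal A → r (B ∪ A) ≡ r A + r B
    r-B∪A {A} A⊆X st = trans (avoiding-splits (st-B∪A A⊆X st) (ω-avoids-B∪A A⊆X))
      (cong₂ (λ C D → r C + r D) ([B∪A]∩X≡A A⊆X) ([B∪A]─X≡B A⊆X))

    module Raising (e-raises-B : r (B ∪⁅ e ⁆) ≡ suc (r B)) where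

      e-raises-B∪A : ∀ {A} → A ⊆ X → Subtransversal A → r (B ∪ A ∪⁅ e ⁆) ≡ suc (r (B ∪ A))
      e-raises-B∪A {A} A⊆X st = begin
        r (B ∪ A ∪⁅ e ⁆)                       ≡⟨ minor-splits (st-B∪A A⊆X st) (ω-avoids-B∪A A⊆X) ⟩
        r ((B ∪ A) ∩ X) + r ((B ∪ A) ─ X ∪⁅ e ⁆) ≡⟨ cong₂ (λ C D → r C + r (D ∪⁅ e ⁆))
                                                      ([B∪A]∩X≡A A⊆X) ([B∪A]─X≡B A⊆X) ⟩
        r A + r (B ∪⁅ e ⁆)                     ≡⟨ cong (r A +_) e-raises-B ⟩
        r A + suc (r B)                        ≡⟨ +-suc (r A) (r B) ⟩
        suc (r A + r B)                        ≡⟨ cong suc (sym (r-B∪A A⊆X st)) ⟩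
        suc (r (B ∪ A))                        ∎
        where open ≡-Reasoning

      SpannedAt : Subset n → Set
      SpannedAt U = ∃[ x ] (cls x ≡ ω × Spans U x)

      Step : Subset n → Set
      Step A = ∀ a → a ∈ X → ¬ Meets A (cls a) → SpannedAt (B ∪ A ∪⁅ a ⁆)

      fill-st : ∀ {A a} → Subtransversal A → ¬ Meets A (cls a) → Subtransversal (A ∪⁅ a ⁆)
      fill-st st unmet = subtransversal-∪⁅⁆ st (unmet⇒avoids unmet)

      -- e raises the rank of both B ∪ A and B ∪ A ∪ a by one
      spans-without-e : ∀ {A a} → A ⊆ X → Subtransversal A → a ∈ X → ¬ Meets A (cls a) →
                        Spans (B ∪ A ∪⁅ e ⁆) a → Spans (B ∪ A) a
      spans-without-e {A} {a} A⊆X st a∈X a-unmet spanned = suc-injective (begin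
        suc (r (B ∪ A ∪⁅ a ⁆))        ≡⟨ cong (λ C → suc (r C)) (∪-assoc B A ⁅ a ⁆) ⟩
        suc (r (B ∪ (A ∪⁅ a ⁆)))      ≡⟨ sym (e-raises-B∪A (p⊆q∧x∈q⇒p∪⁅x⁆⊆q A⊆X a∈X)
                                                           (fill-st st a-unmet)) ⟩
        r (B ∪ (A ∪⁅ a ⁆) ∪⁅ e ⁆)     ≡⟨ cong (λ C → r (C ∪⁅ e ⁆)) (sym (∪-assoc B A ⁅ a ⁆)) ⟩
        r (B ∪ A ∪⁅ a ⁆ ∪⁅ e ⁆)       ≡⟨ cong r ∪⁅⁆-comm ⟩
        r (B ∪ A ∪⁅ e ⁆ ∪⁅ a ⁆)       ≡⟨ spanned ⟩
        r (B ∪ A ∪⁅ e ⁆)              ≡⟨ e-raises-B∪A A⊆X st ⟩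
        suc (r (B ∪ A))               ∎)
        where open ≡-Reasoning

      spanned-via : ∀ {A a} → A ⊆ X → Subtransversal A → a ∈ X → ¬ Meets A (cls a) →
                    Spans (B ∪ A) a → SpannedAt (B ∪ A ∪⁅ a ⁆) → SpannedAt (B ∪ A)
      spanned-via {A} {a} A⊆X st a∈X a-unmet a-spanned (x , cx≡ω , x-spanned) =
        x , cx≡ω , spans-trans st-Uax x-avoids a-spanned x-spanned
        where
        a-avoids = unmet-avoids-B∪A a∈X a-unmet
        x-avoids : ClassAvoids cls (cls x) (B ∪ A)
        x-avoids = subst (λ c → ClassAvoids cls c (B ∪ A)) (sym cx≡ω) (ω-avoids-B∪A A⊆X)
        st-Uax = subtransversal-∪⁅⁆ (subtransversal-∪⁅⁆ (st-B∪A A⊆X st) a-avoids)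
                   (classAvoids-∪⁅⁆ x-avoids (λ ca≡cx → X-avoids-ω a∈X (trans ca≡cx cx≡ω)))

      spanned-if-saturated : ∀ {A} → A ⊆ X → Subtransversal A → (∀ {z} → z ∈ X → Meets A (cls z)) →
                             SpannedAt (B ∪ A)
      spanned-if-saturated {A} A⊆X st saturated =
        spanned-exists (st-B∪A A⊆X st) (ω-avoids-B∪A A⊆X) meets
        where
        meets : ∀ c → c ≢ ω → Meets (B ∪ A) c
        meets c c≢ω with meets? X c
        ... | yes (z , z∈X , cz≡c) with saturated z∈X
        ...   | y , y∈A , cy≡cz = y , q⊆p∪q B A y∈A , trans cy≡cz cz≡c
        meets c c≢ω | no X-unmet with B-meets c c≢ω X-unmet
        ...   | y , y∈B , cy≡c = y , p⊆p∪q A y∈B , cy≡c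

      spanned-if-one-gap : ∀ {A z} → A ⊆ X → Subtransversal A → z ∈ X → ¬ Meets A (cls z) →
                           (∀ {z′} → z′ ∈ X → cls z′ ≢ cls z → Meets A (cls z′)) → Step A →
                           SpannedAt (B ∪ A)
      spanned-if-one-gap {A} {z} A⊆X st z∈X z-unmet saturated step =
        continue (spanned-exists (subtransversal-∪⁅⁆ st-U (ω-avoids-B∪A A⊆X)) z-avoids meets)
        where
        U = B ∪ A
        st-U = st-B∪A A⊆X st
        z-avoids : ClassAvoids cls (cls z) (U ∪⁅ e ⁆)
        z-avoids = classAvoids-∪⁅⁆ (unmet-avoids-B∪A z∈X z-unmet) (λ ω≡cz → X-avoids-ω z∈X (sym ω≡cz))
        meets : ∀ c → c ≢ cls z → Meets (U ∪⁅ e ⁆) c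
        meets c c≢cz with c ≟ ω | meets? X c
        ... | yes c≡ω | _ = e , x∈p∪⁅x⁆ , sym c≡ω
        ... | no c≢ω | yes (z′ , z′∈X , cz′≡c) with saturated z′∈X (λ cz′≡cz → c≢cz (trans (sym cz′≡c) cz′≡cz))
        ...   | y , y∈A , cy≡cz′ = y , p⊆p∪⁅x⁆ (q⊆p∪q B A y∈A) , trans cy≡cz′ cz′≡c
        meets c c≢cz | no c≢ω | no X-unmet with B-meets c c≢ω X-unmet
        ...   | y , y∈B , cy≡c = y , p⊆p∪⁅x⁆ (p⊆p∪q A y∈B) , cy≡c
        continue : ∃[ a ] (cls a ≡ cls z × Spans (U ∪⁅ e ⁆) a) → SpannedAt U
        continue (a , ca≡cz , a-spanned) =
          spanned-via A⊆X st a∈X a-unmet (spans-without-e A⊆X st a∈X a-unmet a-spanned) (step a a∈X a-unmet)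
          where
          a∈X = X-closed z∈X ca≡cz
          a-unmet : ¬ Meets A (cls a)
          a-unmet = subst (λ c → ¬ Meets A c) (sym ca≡cz) z-unmet

      spanned-if-two-gaps : ∀ {A z b} → A ⊆ X → Subtransversal A → z ∈ X → ¬ Meets A (cls z) →
                            b ∈ X → ¬ Meets A (cls b) → cls b ≢ cls z → Step A → SpannedAt (B ∪ A)
      spanned-if-two-gaps {A} {z} {b} A⊆X st z∈X z-unmet b∈X b-unmet cb≢cz step =
        continue (step b b∈X b-unmet)
        where
        U = B ∪ A
        st-U = st-B∪A A⊆X st
        ω-avoids-U = ω-avoids-B∪A A⊆X
        continue : SpannedAt (U ∪⁅ b ⁆) → SpannedAt U
        continue (x , cx≡ω , x-spanned) = x , cx≡ω ,
          spans-of-all-extensions st-U (subst (λ c → ClassAvoids cls c U) (sym cx≡ω) ω-avoids-U)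
            (classAvoids-∪⁅⁆ (unmet-avoids-B∪A z∈X z-unmet) (λ cx≡cz → X-avoids-ω z∈X (trans (sym cx≡cz) cx≡ω)))
            spanned-after-y
          where
          -- at U ∪ y ∪ b at most one element of ω is spanned, so filling the gap of z by any y
          -- leads to the same element as filling the gap of b
          spanned-after-y : ∀ y → cls y ≡ cls z → Spans (U ∪⁅ y ⁆) x
          spanned-after-y y cy≡cz = agree (step y y∈X y-unmet)
            where
            y∈X = X-closed z∈X cy≡cz
            y-unmet : ¬ Meets A (cls y)
            y-unmet = subst (λ c → ¬ Meets A c) (sym cy≡cz) z-unmet
            V = U ∪⁅ y ⁆ ∪⁅ b ⁆
            st-V : Subtransversal V
            st-V = subtransversal-∪⁅⁆ (subtransversal-∪⁅⁆ st-U (unmet-avoids-B∪A y∈X y-unmet))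
                     (classAvoids-∪⁅⁆ (unmet-avoids-B∪A b∈X b-unmet) (λ cy≡cb → cb≢cz (trans (sym cy≡cb) cy≡cz)))
            ω-avoids-V : ClassAvoids cls ω V
            ω-avoids-V = classAvoids-∪⁅⁆ (classAvoids-∪⁅⁆ ω-avoids-U (X-avoids-ω y∈X)) (X-avoids-ω b∈X)
            spanned-in-V : ∀ {w C} → cls w ≡ ω → C ⊆ V → Spans C w → Spans V w
            spanned-in-V cw≡ω C⊆V = spans-⊆ C⊆V
              (subtransversal-∪⁅⁆ st-V (subst (λ c → ClassAvoids cls c V) (sym cw≡ω) ω-avoids-V))
              (λ w∈V → ω-avoids-V _ w∈V cw≡ω)
            agree : SpannedAt (U ∪⁅ y ⁆) → Spans (U ∪⁅ y ⁆) x
            agree (x′ , cx′≡ω , x′-spanned) = subst (Spans (U ∪⁅ y ⁆))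
              (spans-unique st-V (subst (λ c → ClassAvoids cls c V) (sym cx′≡ω) ω-avoids-V)
                 (trans cx≡ω (sym cx′≡ω))
                 (spanned-in-V cx′≡ω p⊆p∪⁅x⁆ x′-spanned)
                 (spanned-in-V cx≡ω (∪⁅⁆-mono p⊆p∪⁅x⁆) x-spanned))
              x′-spanned

      spanned-step : ∀ {A} → A ⊆ X → Subtransversal A → Step A → SpannedAt (B ∪ A)
      spanned-step {A} A⊆X st step with any? (λ z → z ∈? X ×-dec ¬? (meets? A (cls z)))
      ... | no no-gap = spanned-if-saturated A⊆X st
            (λ {z} z∈X → decidable-stable (meets? A (cls z)) (λ z-unmet → no-gap (z , z∈X , z-unmet)))
      ... | yes (z , z∈X , z-unmet)
            with any? (λ b → b ∈? X ×-dec ¬? (meets? A (cls b)) ×-dec ¬? (cls b ≟ cls z))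
      ...   | yes (b , b∈X , b-unmet , cb≢cz) = spanned-if-two-gaps A⊆X st z∈X z-unmet b∈X b-unmet cb≢cz step
      ...   | no one-gap = spanned-if-one-gap A⊆X st z∈X z-unmet
              (λ {z′} z′∈X cz′≢cz → decidable-stable (meets? A (cls z′))
                 (λ z′-unmet → one-gap (z′ , z′∈X , z′-unmet , cz′≢cz)))
              step

      spanned : ∀ A → Acc _⊃_ A → A ⊆ X → Subtransversal A → SpannedAt (B ∪ A)
      spanned A (acc rec) A⊆X st = spanned-step A⊆X st step
        where
        step : Step A
        step a a∈X a-unmet = subst SpannedAt (sym (∪-assoc B A ⁅ a ⁆))
          (spanned (A ∪⁅ a ⁆) (rec (x∉p⇒p⊂p∪⁅x⁆ (λ a∈A → a-unmet (a , a∈A , refl))))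
            (p⊆q∧x∈q⇒p∪⁅x⁆⊆q A⊆X a∈X) (fill-st st a-unmet))

    ω-spanned : ∃[ x ] (cls x ≡ ω × Spans B x)
    ω-spanned with spans⊎r-∪⁅⁆≡1+r st-B ω-avoids-B
    ... | inj₁ e-spanned  = e , refl , e-spanned
    ... | inj₂ e-raises-B = subst SpannedAt (∪-identityʳ B) (spanned ⊥ (⊃-wellFounded ⊥) ⊥⊆ subtransversal-⊥)
      where open Raising e-raises-B

  transversal-splits : ∀ {S t} → Subtransversal S → ClassAvoids cls ω S → cls t ≡ ω →
                       (∀ c → c ≢ ω → Meets S c) → Splits X (S ∪⁅ t ⁆)
  transversal-splits {S} {t} st ω-avoids ct≡ω meets =
    ≤-antisym (r≤r∩+r─ X st-S∪t)
      (subst₂ (λ C D → r C + r D ≤ r (S ∪⁅ t ⁆))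
        (sym (x∉q⇒[p∪⁅x⁆]∩q≡p∩q t∉X)) (sym (x∉q⇒[p∪⁅x⁆]─q≡[p─q]∪⁅x⁆ t∉X))
        r-S∩X+r-S─X∪t≤r-S∪t)
    where
    t∉X : t ∉ X
    t∉X t∈X = X-avoids-ω t∈X ct≡ω
    ω-class-avoids : ∀ {x} → cls x ≡ ω → ClassAvoids cls (cls x) S
    ω-class-avoids cx≡ω = subst (λ c → ClassAvoids cls c S) (sym cx≡ω) ω-avoids
    t-avoids = ω-class-avoids ct≡ω
    spanned-in-S : ∀ {x} → cls x ≡ ω → Spans (S ─ X) x → Spans S x
    spanned-in-S cx≡ω = spans-⊆ (p─q⊆p S X) (subtransversal-∪⁅⁆ st (ω-class-avoids cx≡ω))
                          (λ x∈S → ω-avoids _ x∈S cx≡ω)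
    st-S∪t = subtransversal-∪⁅⁆ st t-avoids
    S─X-meets : ∀ c → c ≢ ω → ¬ Meets X c → Meets (S ─ X) c
    S─X-meets c c≢ω X-unmet with meets c c≢ω
    ... | y , y∈S , cy≡c = y , x∈p∧x∉q⇒x∈p─q y∈S (λ y∈X → X-unmet (y , y∈X , cy≡c)) , cy≡c
    open Spanning (S ─ X) (subtransversal-⊆ (p─q⊆p S X) st) x∈p─q⇒x∉q
                  (classAvoids-⊆ (p─q⊆p S X) ω-avoids) S─X-meets
    r-S∩X+r-S─X∪t≤r-S∪t : r (S ∩ X) + r (S ─ X ∪⁅ t ⁆) ≤ r (S ∪⁅ t ⁆)
    r-S∩X+r-S─X∪t≤r-S∪t with ω-spanned
    ... | x , cx≡ω , x-spanned-S─X with x ≟ t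
    ...   | yes refl = ≤-reflexive (begin
            r (S ∩ X) + r (S ─ X ∪⁅ x ⁆)   ≡⟨ cong (r (S ∩ X) +_) x-spanned-S─X ⟩
            r (S ∩ X) + r (S ─ X)          ≡⟨ sym (avoiding-splits st ω-avoids) ⟩
            r S                            ≡⟨ sym (spanned-in-S cx≡ω x-spanned-S─X) ⟩
            r (S ∪⁅ x ⁆)                   ∎)
      where open ≡-Reasoning
    ...   | no x≢t with spans⊎r-∪⁅⁆≡1+r st t-avoids
    ...     | inj₁ t-spanned = ⊥-elim (x≢t (spans-unique st (ω-class-avoids cx≡ω) (trans ct≡ω (sym cx≡ω))
                                          (spanned-in-S cx≡ω x-spanned-S─X) t-spanned))
    ...     | inj₂ t-raises = begin
            r (S ∩ X) + r (S ─ X ∪⁅ t ⁆)   ≤⟨ +-monoʳ-≤ (r (S ∩ X))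
                                                (r-∪⁅⁆≤1+r (subtransversal-⊆ (p─q⊆p S X) st)
                                                  (classAvoids-⊆ (p─q⊆p S X) t-avoids)) ⟩
            r (S ∩ X) + suc (r (S ─ X))    ≡⟨ +-suc (r (S ∩ X)) (r (S ─ X)) ⟩
            suc (r (S ∩ X) + r (S ─ X))    ≡⟨ cong suc (sym (avoiding-splits st ω-avoids)) ⟩
            suc (r S)                      ≡⟨ sym t-raises ⟩
            r (S ∪⁅ t ⁆)                   ∎
      where open ≤-Reasoning

  subtransversal-splits : ∀ {S} → Subtransversal S → Splits X S
  subtransversal-splits {S} st with extend {P = λ _ → Unit} (λ _ → yes tt) st
  ... | record { T = T ; S⊆T = S⊆T ; T-st = T-st ; T-meets = T-meets } with T-meets ω tt
  ...   | t , t∈T , ct≡ω = splits-⊆ X S⊆T T-st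
          (subst (Splits X) (p-x∪⁅x⁆≡p t∈T)
            (transversal-splits (subtransversal-⊆ p-x⊆p T-st) ω-avoids ct≡ω meets))
    where
    ω-avoids : ClassAvoids cls ω (T - t)
    ω-avoids = subst (λ c → ClassAvoids cls c (T - t)) ct≡ω
                 (subtransversal⇒classAvoids T-st p-x⊆p t∈T x∉p-x)
    meets : ∀ c → c ≢ ω → Meets (T - t) c
    meets c c≢ω with T-meets c tt
    ... | y , y∈T , cy≡c = y , x∈p∧x≢y⇒x∈p-y y∈T (λ { refl → c≢ω (trans (sym cy≡c) ct≡ω) }) , cy≡c

  separates : Whole.IsSeparator Q X
  separates = ((λ _ _ → tt) , (λ x y x∈X _ cx≡cy → X-closed x∈X (sym cx≡cy))) ,
              (λ S (_ , st) → subtransversal-splits st)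

module _ {n : ℕ} (Q : Multimatroid n) (tight : IsTight Q) (e : Fin n) (X : Subset n)
         (X-separates : Minor.IsSeparator Q ⁅ e ⁆ X) where
  open Multimatroid Q
  open Rank Q
  open MinorSeparator Q e X X-separates

  circuit⊎separator : ∃[ C ] (IsCircuit Q C × e ∈ C × C ⊆ X ∪ ⁅ e ⁆) ⊎ Whole.IsSeparator Q X
  circuit⊎separator with anySubset? (λ A → A ⊆? X ×-dec subtransversal? A ×-dec r (A ∪⁅ e ⁆) ≟ℕ r A)
  ... | yes (A , A⊆X , st , A-spans) = inj₁ (circuit-in-X A⊆X st A-spans)
  ... | no none = inj₂ (Separation.separates Q tight e X X-separates e-raises)
    where
    e-raises : ∀ A → A ⊆ X → Subtransversal A → r (A ∪⁅ e ⁆) ≡ suc (r A)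
    e-raises A A⊆X st with spans⊎r-∪⁅⁆≡1+r st (ω-avoids-⊆X A⊆X)
    ... | inj₁ A-spans = ⊥-elim (none (A , A⊆X , st , A-spans))
    ... | inj₂ raises  = raises

lemma9 : ∀ {n} (Q : Multimatroid n) → IsTight Q → Whole.IsConnected Q →
         (e : Fin n) → Minor.IsDisconnected Q ⁅ e ⁆ →
         (X : Subset n) → Minor.IsSeparator Q ⁅ e ⁆ X → Minor.IsProper Q ⁅ e ⁆ X →
         ∃[ C ] (IsCircuit Q C × e ∈ C × C ⊆ X ∪ ⁅ e ⁆)
-- the disconnectedness of Q|e is witnessed by X itself
lemma9 Q tight connected e _ X X-separates (X-nonempty , _) with circuit⊎separator Q tight e X X-separates
... | inj₁ circuit       = circuit
... | inj₂ X-separates-Q = ⊥-elim (connected X X-separates-Q (X-nonempty , e , tt , e∉X))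
  where open MinorSeparator Q e X X-separates
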